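{- Let $\mathbf{D},\mathbf{A},\tilde{\mathbf{A}}$ be real symmetric $n\times n$ matrices with $0\preccurlyeq\mathbf{A}$ and $\epsilon\ge 0$. If $(1-\epsilon)(\mathbf{D}-\mathbf{A})\preccurlyeq\mathbf{D}-\tilde{\mathbf{A}}\preccurlyeq(1+\epsilon)(\mathbf{D}-\mathbf{A})$, then $(1-\epsilon)(\mathbf{D}+\mathbf{A})\preccurlyeq\mathbf{D}+\tilde{\mathbf{A}}\preccurlyeq(1+\epsilon)(\mathbf{D}+\mathbf{A})$.
   Context: $\preccurlyeq$ is the Loewner order: $\mathbf{X}\preccurlyeq\mathbf{Y}$ iff $\mathbf{Y}-\mathbf{X}$ is positive semidefinite. -}

module Defs where

open import Level using (Level; _⊔_; suc)
open import Data.Nat using (ℕ; zero) renaming (suc to sucℕ)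
open import Data.Fin using (Fin) renaming (zero to fzero; suc to fsuc)
open import Data.Product using (Σ; _×_; ∃)
open import Relation.Nullary using (¬_)
open import Relation.Binary.Structures using (IsTotalOrder)
open import Algebra.Bundles using (CommutativeRing)

-- An axiomatic model of the real numbers: a complete (Dedekind/sup-complete)
-- ordered field.  Any two models are isomorphic, so quantifying over all
-- models is the same as speaking about ℝ.
record RealField (c ℓ₁ ℓ₂ : Level) : Set (Level.suc (c ⊔ ℓ₁ ⊔ ℓ₂)) where
  field
    commRing : CommutativeRing c ℓ₁
  open CommutativeRing commRing public
  field
    _≤_          : Carrier → Carrier → Set ℓ₂
    isTotalOrder : IsTotalOrder _≈_ _≤_
    nontrivial   : ¬ (0# ≈ 1#)
    inverse      : ∀ x → ¬ (x ≈ 0#) → Σ Carrier (λ y → (x * y) ≈ 1#)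
    +-mono-≤     : ∀ {x y} z → x ≤ y → (x + z) ≤ (y + z)
    *-nonneg     : ∀ {x y} → 0# ≤ x → 0# ≤ y → 0# ≤ (x * y)
    lub : (P : Carrier → Set ℓ₂) → ∃ P → (Σ Carrier λ b → ∀ x → P x → x ≤ b) →
          Σ Carrier λ s → ((∀ x → P x → x ≤ s) ×
                           (∀ b → (∀ x → P x → x ≤ b) → s ≤ b))

module Matrices {c ℓ₁ ℓ₂ : Level} (ℝ : RealField c ℓ₁ ℓ₂) where
  open RealField ℝ

  Matrix : ℕ → Set c
  Matrix n = Fin n → Fin n → Carrier

  Vector : ℕ → Set c
  Vector n = Fin n → Carrier

  sumFin : (n : ℕ) → (Fin n → Carrier) → Carrier
  sumFin zero    f = 0#
  sumFin (sucℕ n) f = f fzero + sumFin n (λ i → f (fsuc i))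

  Symmetric : {n : ℕ} → Matrix n → Set ℓ₁
  Symmetric M = ∀ i j → M i j ≈ M j i

  _⊕_ : {n : ℕ} → Matrix n → Matrix n → Matrix n
  (M ⊕ N) i j = M i j + N i j

  _⊖_ : {n : ℕ} → Matrix n → Matrix n → Matrix n
  (M ⊖ N) i j = M i j - N i j

  _⊙_ : {n : ℕ} → Carrier → Matrix n → Matrix n
  (a ⊙ M) i j = a * M i j

  0M : {n : ℕ} → Matrix n
  0M i j = 0#

  quad : {n : ℕ} → Matrix n → Vector n → Carrier
  quad {n} M x = sumFin n (λ i → sumFin n (λ j → x i * (M i j * x j)))

  PSD : {n : ℕ} → Matrix n → Set (c ⊔ ℓ₂)
  PSD {n} M = ∀ (x : Vector n) → 0# ≤ quad M x

  _≼_ : {n : ℕ} → Matrix n → Matrix n → Set (c ⊔ ℓ₂)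
  X ≼ Y = PSD (Y ⊖ X)

module Submission where

-- For a fixed vector x the quadratic form M ↦ xᵀMx is linear
-- in M, so every Loewner inequality X ≼ Y is, vector by vector, the real
-- inequality 0 ≤ xᵀYx - xᵀXx.  Writing d = xᵀDx, a = xᵀAx, t = xᵀÃx, the
-- theorem therefore reduces to its one-dimensional case, which follows from
-- the two ring identities
--   (d + t) - (1-ε)(d + a) = ((1+ε)(d - a) - (d - t)) + 2ε a,
--   (1+ε)(d + a) - (d + t) = ((d - t) - (1-ε)(d - a)) + 2ε a,
-- since a ≥ 0 and ε ≥ 0.  Note that each half of the conclusion uses the
-- opposite half of the hypothesis.

open import Defs
open import Level using (Level)
open import Data.Nat using (ℕ; zero) renaming (suc to sucℕ)
open import Data.Fin using (Fin) renaming (zero to fzero; suc to fsuc)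
open import Data.Product using (_×_; _,_)
open import Algebra.Bundles using (CommutativeRing)
import Algebra.Properties.Ring as RingProperties
import Algebra.Properties.CommutativeSemigroup as CommutativeSemigroupProperties
import Relation.Binary.Reasoning.Setoid as SetoidReasoning
open import Relation.Binary.Structures using (IsTotalOrder)

module RingIdentities {c ℓ : Level} (R : CommutativeRing c ℓ) where
  open CommutativeRing R
  open RingProperties ring
    using (-‿+-comm; ⁻¹-anti-homo‿-; -‿involutive; [y-z]x≈yx-zx)
  open CommutativeSemigroupProperties +-commutativeSemigroup using (interchange)
  open SetoidReasoning setoid

  sub-sub : ∀ x y z → x - (y - z) ≈ (x - y) + z
  sub-sub x y z = begin
    x + - (y - z)   ≈⟨ +-congˡ (⁻¹-anti-homo‿- y z) ⟩
    x + (z - y)     ≈⟨ +-congˡ (+-comm z (- y)) ⟩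
    x + (- y + z)   ≈⟨ +-assoc x (- y) z ⟨
    (x - y) + z     ∎

  add-sub : ∀ x y z → (x + y) - z ≈ (x - z) + y
  add-sub x y z = begin
    (x + y) + - z   ≈⟨ +-assoc x y (- z) ⟩
    x + (y + - z)   ≈⟨ +-congˡ (+-comm y (- z)) ⟩
    x + (- z + y)   ≈⟨ +-assoc x (- z) y ⟨
    (x - z) + y     ∎

  add-sub-add : ∀ x y z → (x + y) - (x + z) ≈ y - z
  add-sub-add x y z = begin
    (x + y) + - (x + z)     ≈⟨ +-congˡ (-‿+-comm x z) ⟨
    (x + y) + (- x + - z)   ≈⟨ interchange x y (- x) (- z) ⟩
    (x - x) + (y - z)       ≈⟨ +-congʳ (-‿inverseʳ x) ⟩
    0# + (y - z)            ≈⟨ +-identityˡ (y - z) ⟩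
    y - z                   ∎

  sub-sub-sub : ∀ x y z → (x - y) - (x - z) ≈ z - y
  sub-sub-sub x y z = begin
    (x - y) - (x - z)   ≈⟨ add-sub-add x (- y) (- z) ⟩
    - y + - - z         ≈⟨ +-congˡ (-‿involutive z) ⟩
    - y + z             ≈⟨ +-comm (- y) z ⟩
    z - y               ∎

  one-sub-mul : ∀ e y → (1# - e) * y ≈ y - e * y
  one-sub-mul e y = trans ([y-z]x≈yx-zx y 1# e) (+-congʳ (*-identityˡ y))

  one-add-mul : ∀ e y → (1# + e) * y ≈ y + e * y
  one-add-mul e y = trans (distribʳ y 1# e) (+-congʳ (*-identityˡ y))

  shift-by-double : ∀ e d a → e * (d - a) + (e + e) * a ≈ e * (d + a)
  shift-by-double e d a = begin
    e * (d - a) + (e + e) * a       ≈⟨ +-congˡ (distribʳ a e e) ⟩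
    e * (d - a) + (e * a + e * a)   ≈⟨ +-congˡ (distribˡ e a a) ⟨
    e * (d - a) + e * (a + a)       ≈⟨ distribˡ e (d - a) (a + a) ⟨
    e * ((d + - a) + (a + a))       ≈⟨ *-congˡ (+-assoc d (- a) (a + a)) ⟩
    e * (d + (- a + (a + a)))       ≈⟨ *-congˡ (+-congˡ (+-assoc (- a) a a)) ⟨
    e * (d + ((- a + a) + a))       ≈⟨ *-congˡ (+-congˡ (+-congʳ (-‿inverseˡ a))) ⟩
    e * (d + (0# + a))              ≈⟨ *-congˡ (+-congˡ (+-identityˡ a)) ⟩
    e * (d + a)                     ∎

  lower-identity : ∀ d a t e →
    (d + t) - (1# - e) * (d + a) ≈ ((1# + e) * (d - a) - (d - t)) + (e + e) * a
  lower-identity d a t e = begin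
    (d + t) - (1# - e) * (d + a)                       ≈⟨ +-congˡ (-‿cong (one-sub-mul e (d + a))) ⟩
    (d + t) - ((d + a) - e * (d + a))                  ≈⟨ sub-sub (d + t) (d + a) (e * (d + a)) ⟩
    ((d + t) - (d + a)) + e * (d + a)                  ≈⟨ +-congʳ (add-sub-add d t a) ⟩
    (t - a) + e * (d + a)                              ≈⟨ +-congˡ (shift-by-double e d a) ⟨
    (t - a) + (e * (d - a) + (e + e) * a)              ≈⟨ +-assoc (t - a) (e * (d - a)) ((e + e) * a) ⟨
    ((t - a) + e * (d - a)) + (e + e) * a              ≈⟨ +-congʳ (+-congʳ (sub-sub-sub d a t)) ⟨
    (((d - a) - (d - t)) + e * (d - a)) + (e + e) * a  ≈⟨ +-congʳ (add-sub (d - a) (e * (d - a)) (d - t)) ⟨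
    (((d - a) + e * (d - a)) - (d - t)) + (e + e) * a  ≈⟨ +-congʳ (+-congʳ (one-add-mul e (d - a))) ⟨
    ((1# + e) * (d - a) - (d - t)) + (e + e) * a       ∎

  upper-identity : ∀ d a t e →
    (1# + e) * (d + a) - (d + t) ≈ ((d - t) - (1# - e) * (d - a)) + (e + e) * a
  upper-identity d a t e = begin
    (1# + e) * (d + a) - (d + t)                       ≈⟨ +-congʳ (one-add-mul e (d + a)) ⟩
    ((d + a) + e * (d + a)) - (d + t)                  ≈⟨ add-sub (d + a) (e * (d + a)) (d + t) ⟩
    ((d + a) - (d + t)) + e * (d + a)                  ≈⟨ +-congʳ (add-sub-add d a t) ⟩
    (a - t) + e * (d + a)                              ≈⟨ +-congˡ (shift-by-double e d a) ⟨
    (a - t) + (e * (d - a) + (e + e) * a)              ≈⟨ +-assoc (a - t) (e * (d - a)) ((e + e) * a) ⟨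
    ((a - t) + e * (d - a)) + (e + e) * a              ≈⟨ +-congʳ (+-congʳ (sub-sub-sub d t a)) ⟨
    (((d - t) - (d - a)) + e * (d - a)) + (e + e) * a  ≈⟨ +-congʳ (sub-sub (d - t) (d - a) (e * (d - a))) ⟨
    ((d - t) - ((d - a) - e * (d - a))) + (e + e) * a  ≈⟨ +-congʳ (+-congˡ (-‿cong (one-sub-mul e (d - a)))) ⟨
    ((d - t) - (1# - e) * (d - a)) + (e + e) * a       ∎

module RealMatrices {c ℓ₁ ℓ₂ : Level} (ℝ : RealField c ℓ₁ ℓ₂) where
  open RealField ℝ
  open Matrices ℝ
  open RingProperties ring using (-0#≈0#; -‿+-comm; [y-z]x≈yx-zx; x[y-z]≈xy-xz)
  open CommutativeSemigroupProperties *-commutativeSemigroup using (x∙yz≈y∙xz)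
  open RingIdentities commRing using (lower-identity; upper-identity)
  open SetoidReasoning setoid
  open IsTotalOrder isTotalOrder using (≲-respʳ-≈; ≲-respˡ-≈) renaming (trans to ≤-trans)

  -- Nonnegative reals are closed under addition: 0 ≈ 0 + 0 ≤ b + 0 ≈ 0 + b ≤ a + b.
  nonneg-+ : ∀ {a b} → 0# ≤ a → 0# ≤ b → 0# ≤ (a + b)
  nonneg-+ {a} {b} 0≤a 0≤b =
    ≤-trans (≲-respʳ-≈ (trans (+-identityʳ b) (sym (+-identityˡ b)))
                       (≲-respˡ-≈ (+-identityʳ 0#) (+-mono-≤ 0# 0≤b)))
            (+-mono-≤ b 0≤a)

  scalar-lower : ∀ d a t e → 0# ≤ a → 0# ≤ e →
    0# ≤ ((1# + e) * (d - a) - (d - t)) → 0# ≤ ((d + t) - (1# - e) * (d + a))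
  scalar-lower d a t e 0≤a 0≤e hyp =
    ≲-respʳ-≈ (sym (lower-identity d a t e)) (nonneg-+ hyp (*-nonneg (nonneg-+ 0≤e 0≤e) 0≤a))

  scalar-upper : ∀ d a t e → 0# ≤ a → 0# ≤ e →
    0# ≤ ((d - t) - (1# - e) * (d - a)) → 0# ≤ ((1# + e) * (d + a) - (d + t))
  scalar-upper d a t e 0≤a 0≤e hyp =
    ≲-respʳ-≈ (sym (upper-identity d a t e)) (nonneg-+ hyp (*-nonneg (nonneg-+ 0≤e 0≤e) 0≤a))

  sumFin-cong : ∀ n {f g : Fin n → Carrier} → (∀ i → f i ≈ g i) → sumFin n f ≈ sumFin n g
  sumFin-cong zero     f≈g = refl
  sumFin-cong (sucℕ n) f≈g = +-cong (f≈g fzero) (sumFin-cong n (λ i → f≈g (fsuc i)))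

  sumFin-+ : ∀ n (f g : Fin n → Carrier) →
    sumFin n (λ i → f i + g i) ≈ sumFin n f + sumFin n g
  sumFin-+ zero     f g = sym (+-identityʳ 0#)
  sumFin-+ (sucℕ n) f g = begin
    (f fzero + g fzero) + sumFin n (λ i → f (fsuc i) + g (fsuc i))
      ≈⟨ +-congˡ (sumFin-+ n (λ i → f (fsuc i)) (λ i → g (fsuc i))) ⟩
    (f fzero + g fzero) + (sumFin n (λ i → f (fsuc i)) + sumFin n (λ i → g (fsuc i)))
      ≈⟨ interchange (f fzero) (g fzero) _ _ ⟩
    sumFin (sucℕ n) f + sumFin (sucℕ n) g ∎
    where open CommutativeSemigroupProperties +-commutativeSemigroup using (interchange)

  sumFin-neg : ∀ n (f : Fin n → Carrier) → sumFin n (λ i → - f i) ≈ - sumFin n f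
  sumFin-neg zero     f = sym -0#≈0#
  sumFin-neg (sucℕ n) f =
    trans (+-congˡ (sumFin-neg n (λ i → f (fsuc i)))) (-‿+-comm (f fzero) _)

  sumFin-scale : ∀ n k (f : Fin n → Carrier) → sumFin n (λ i → k * f i) ≈ k * sumFin n f
  sumFin-scale zero     k f = sym (zeroʳ k)
  sumFin-scale (sucℕ n) k f =
    trans (+-congˡ (sumFin-scale n k (λ i → f (fsuc i)))) (sym (distribˡ k (f fzero) _))

  quad-⊕ : ∀ {n} (M N : Matrix n) x → quad (M ⊕ N) x ≈ quad M x + quad N x
  quad-⊕ {n} M N x = begin
    quad (M ⊕ N) x
      ≈⟨ sumFin-cong n (λ i → sumFin-cong n (λ j →
           trans (*-congˡ (distribʳ (x j) (M i j) (N i j))) (distribˡ (x i) _ _))) ⟩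
    sumFin n (λ i → sumFin n (λ j → x i * (M i j * x j) + x i * (N i j * x j)))
      ≈⟨ sumFin-cong n (λ i → sumFin-+ n _ _) ⟩
    sumFin n (λ i → sumFin n (λ j → x i * (M i j * x j)) + sumFin n (λ j → x i * (N i j * x j)))
      ≈⟨ sumFin-+ n _ _ ⟩
    quad M x + quad N x ∎

  quad-⊖ : ∀ {n} (M N : Matrix n) x → quad (M ⊖ N) x ≈ quad M x - quad N x
  quad-⊖ {n} M N x = begin
    quad (M ⊖ N) x
      ≈⟨ sumFin-cong n (λ i → sumFin-cong n (λ j →
           trans (*-congˡ ([y-z]x≈yx-zx (x j) (M i j) (N i j))) (x[y-z]≈xy-xz (x i) _ _))) ⟩
    sumFin n (λ i → sumFin n (λ j → x i * (M i j * x j) - x i * (N i j * x j)))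
      ≈⟨ sumFin-cong n (λ i → trans (sumFin-+ n _ _) (+-congˡ (sumFin-neg n _))) ⟩
    sumFin n (λ i → sumFin n (λ j → x i * (M i j * x j)) - sumFin n (λ j → x i * (N i j * x j)))
      ≈⟨ trans (sumFin-+ n _ _) (+-congˡ (sumFin-neg n _)) ⟩
    quad M x - quad N x ∎

  quad-⊙ : ∀ {n} k (M : Matrix n) x → quad (k ⊙ M) x ≈ k * quad M x
  quad-⊙ {n} k M x = begin
    quad (k ⊙ M) x
      ≈⟨ sumFin-cong n (λ i → sumFin-cong n (λ j →
           trans (*-congˡ (*-assoc k (M i j) (x j))) (x∙yz≈y∙xz (x i) k _))) ⟩
    sumFin n (λ i → sumFin n (λ j → k * (x i * (M i j * x j))))
      ≈⟨ sumFin-cong n (λ i → sumFin-scale n k _) ⟩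
    sumFin n (λ i → k * sumFin n (λ j → x i * (M i j * x j)))
      ≈⟨ sumFin-scale n k _ ⟩
    k * quad M x ∎

  ≼-at : ∀ {n} {X Y : Matrix n} → X ≼ Y → ∀ x → 0# ≤ (quad Y x - quad X x)
  ≼-at {X = X} {Y} X≼Y x = ≲-respʳ-≈ (quad-⊖ Y X x) (X≼Y x)

  ≼-intro : ∀ {n} {X Y : Matrix n} → (∀ x → 0# ≤ (quad Y x - quad X x)) → X ≼ Y
  ≼-intro {X = X} {Y} h x = ≲-respʳ-≈ (sym (quad-⊖ Y X x)) (h x)

  quad-scaled-⊕ : ∀ {n} k (P Q : Matrix n) x → quad (k ⊙ (P ⊕ Q)) x ≈ k * (quad P x + quad Q x)
  quad-scaled-⊕ k P Q x = trans (quad-⊙ k (P ⊕ Q) x) (*-congˡ (quad-⊕ P Q x))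

  quad-scaled-⊖ : ∀ {n} k (P Q : Matrix n) x → quad (k ⊙ (P ⊖ Q)) x ≈ k * (quad P x - quad Q x)
  quad-scaled-⊖ k P Q x = trans (quad-⊙ k (P ⊖ Q) x) (*-congˡ (quad-⊖ P Q x))

  quad-cong : ∀ {n} {M N : Matrix n} → (∀ i j → M i j ≈ N i j) → ∀ x → quad M x ≈ quad N x
  quad-cong {n} M≈N x =
    sumFin-cong n (λ i → sumFin-cong n (λ j → *-congˡ (*-congʳ (M≈N i j))))

  psd-at : ∀ {n} {A : Matrix n} → 0M ≼ A → ∀ x → 0# ≤ quad A x
  psd-at {A = A} 0≼A x = ≲-respʳ-≈ (quad-cong sub-zero x) (0≼A x)
    where
    sub-zero : ∀ i j → A i j - 0# ≈ A i j
    sub-zero i j = trans (+-congˡ -0#≈0#) (+-identityʳ (A i j))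

  sub-cong : ∀ {a a′ b b′} → a ≈ a′ → b ≈ b′ → a - b ≈ a′ - b′
  sub-cong a≈a′ b≈b′ = +-cong a≈a′ (-‿cong b≈b′)

  loewner-lower : ∀ {n} (D A Ã : Matrix n) ε → 0M ≼ A → 0# ≤ ε →
    (D ⊖ Ã) ≼ ((1# + ε) ⊙ (D ⊖ A)) → ((1# - ε) ⊙ (D ⊕ A)) ≼ (D ⊕ Ã)
  loewner-lower D A Ã ε 0≼A 0≤ε upperHyp = ≼-intro λ x →
    ≲-respʳ-≈ (sym (sub-cong (quad-⊕ D Ã x) (quad-scaled-⊕ (1# - ε) D A x)))
      (scalar-lower (quad D x) (quad A x) (quad Ã x) ε (psd-at 0≼A x) 0≤ε
        (≲-respʳ-≈ (sub-cong (quad-scaled-⊖ (1# + ε) D A x) (quad-⊖ D Ã x))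
          (≼-at upperHyp x)))

  loewner-upper : ∀ {n} (D A Ã : Matrix n) ε → 0M ≼ A → 0# ≤ ε →
    ((1# - ε) ⊙ (D ⊖ A)) ≼ (D ⊖ Ã) → (D ⊕ Ã) ≼ ((1# + ε) ⊙ (D ⊕ A))
  loewner-upper D A Ã ε 0≼A 0≤ε lowerHyp = ≼-intro λ x →
    ≲-respʳ-≈ (sym (sub-cong (quad-scaled-⊕ (1# + ε) D A x) (quad-⊕ D Ã x)))
      (scalar-upper (quad D x) (quad A x) (quad Ã x) ε (psd-at 0≼A x) 0≤ε
        (≲-respʳ-≈ (sub-cong (quad-⊖ D Ã x) (quad-scaled-⊖ (1# - ε) D A x))
          (≼-at lowerHyp x)))

-- Lemma 4.3.
lemma4p3 : {c ℓ₁ ℓ₂ : Level} (ℝ : RealField c ℓ₁ ℓ₂) →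
    let open RealField ℝ
        open Matrices ℝ
    in (n : ℕ) (D A Ã : Matrix n) (ε : Carrier) →
       Symmetric D → Symmetric A → Symmetric Ã →
       0M ≼ A → 0# ≤ ε →
       ((1# - ε) ⊙ (D ⊖ A)) ≼ (D ⊖ Ã) →
       (D ⊖ Ã) ≼ ((1# + ε) ⊙ (D ⊖ A)) →
       (((1# - ε) ⊙ (D ⊕ A)) ≼ (D ⊕ Ã)) × ((D ⊕ Ã) ≼ ((1# + ε) ⊙ (D ⊕ A)))
lemma4p3 ℝ n D A Ã ε _ _ _ 0≼A 0≤ε lowerHyp upperHyp =
  loewner-lower D A Ã ε 0≼A 0≤ε upperHyp , loewner-upper D A Ã ε 0≼A 0≤ε lowerHyp
  where open RealMatrices ℝ using (loewner-lower; loewner-upper)
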